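{- For every square-free word $w\in\{0,1,2\}^*$ with $|w|\ge 26$, we have $\eta(w)\le |w|-5$.
   Context: A word is square-free if it has no factor $vv$ with $v$ nonempty. A position of $w$ is an integer $p$ with $1\le p<|w|$; write $w=xy$ with $|x|=p$. A nonempty word $u$ is a repetition word of $w$ at $p$ if there are (possibly empty) words $x',y'$ with ($u=x'x$ or $x=x'u$) and ($u=yy'$ or $y=uy'$). $\mathrm{per}(w,p)$ is the minimal length of a repetition word at $p$. An integer $q$ with $1\le q\le |w|$ is a period of $w$ if $w$ is a prefix of $z^n$ for some $n$, where $z$ is the prefix of $w$ of length $q$; $\mathrm{per}(w)$ is the minimal period. A position $p$ is critical if $\mathrm{per}(w,p)=\mathrm{per}(w)$, and $\eta(w)$ denotes the number of critical points of $w$. -}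

module Defs where

open import Data.Nat using (ℕ; _≤_; _<_)
open import Data.Fin using (Fin)
open import Data.List using (List; []; _++_; length; take; drop; concat; replicate)
open import Data.Product using (Σ; ∃; _×_)
open import Data.Sum using (_⊎_)
open import Relation.Binary.PropositionalEquality using (_≡_; _≢_)
open import Relation.Nullary using (¬_)

Word : Set
Word = List (Fin 3)

SquareFree : Word → Set
SquareFree w = ¬ (Σ Word λ p → Σ Word λ v → Σ Word λ s → v ≢ [] × w ≡ p ++ v ++ v ++ s)

Position : Word → ℕ → Set
Position w p = 1 ≤ p × p < length w

RepWord : Word → ℕ → Word → Set
RepWord w p u =
  u ≢ [] ×
  (Σ Word λ x' → u ≡ x' ++ take p w ⊎ take p w ≡ x' ++ u) ×
  (Σ Word λ y' → u ≡ drop p w ++ y' ⊎ drop p w ≡ u ++ y')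

LocalPer : Word → ℕ → ℕ → Set
LocalPer w p n =
  (Σ Word λ u → RepWord w p u × length u ≡ n) ×
  (∀ u → RepWord w p u → n ≤ length u)

IsPeriod : Word → ℕ → Set
IsPeriod w q =
  1 ≤ q × q ≤ length w ×
  (Σ ℕ λ n → Σ Word λ t → concat (replicate n (take q w)) ≡ w ++ t)

MinPer : Word → ℕ → Set
MinPer w q = IsPeriod w q × (∀ q' → IsPeriod w q' → q ≤ q')

Critical : Word → ℕ → Set
Critical w p = Position w p × (Σ ℕ λ n → LocalPer w p n × MinPer w n)

module Submission where

-- A square-free word with a period q ≤ |w|/2 would contain the square (w[0..q))², so every period,
-- and hence every repetition word at a critical point, is longer than |w|/2 ≥ 13.  An exhaustive
-- search over the square-free ternary words of length 15 shows that the positions 1, 2, |w|-2, |w|-1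
-- always carry a repetition word of length at most 13, which depends only on the first (last)
-- 15 letters.  So the critical points lie among 3, …, |w|-3.

open import Data.Bool using (Bool; T; _∨_)
open import Data.Bool.ListAction using (all)
open import Data.Bool.Properties using (T-∨)
open import Data.Unit using (tt)
open import Data.Fin using (Fin)
open import Data.Fin.Properties using () renaming (_≟_ to _≟ᶠ_)
open import Data.List using (List; []; _∷_; _++_; length; take; drop; reverse;
  _ʳ++_; head; mapMaybe; upTo; applyUpTo; allFin)
open import Data.List.Properties using (≡-dec; ++-assoc; ++-identityʳ; ++-conicalˡ; take++drop≡id;
  length-take; length-drop; length-++; length-++-≤ˡ; take-all; length-removeAt′; length-applyUpTo;
  ʳ++-defn; reverse-involutive; length-reverse)
open import Data.List.Membership.Propositional using (_∈_; _─_)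
open import Data.List.Membership.Propositional.Properties using (∈-allFin; ∈-applyUpTo⁺)
open import Data.List.Relation.Binary.Subset.Propositional using (_⊆_)
open import Data.List.Relation.Unary.All as All using (All)
open import Data.List.Relation.Unary.All.Properties using (all⁺)
open import Data.List.Relation.Unary.AllPairs using (_∷_)
open import Data.List.Relation.Unary.Any using (here; there)
open import Data.List.Relation.Unary.Unique.Propositional using (Unique)
open import Data.Maybe using (Maybe; just; is-just; zip)
import Data.Maybe as Maybe
open import Data.Nat using (ℕ; zero; suc; _+_; _∸_; _≤_; _<_; _≤?_; z≤n; s≤s)
open import Data.Nat.Properties using (≤-trans; ≤-reflexive; ≤-pred; ≤∧≢⇒<; ≰⇒>; <⇒≱; m<m+n; +-mono-≤;
  m≤n⇒m⊓n≡m; m+[n∸m]≡n; m∸[m∸n]≡n; m∸n≤m; m≤m+n; +-comm)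
open import Data.Product using (Σ; _×_; _,_)
open import Data.Sum using (inj₁; inj₂)
open import Function using (_∘_; Equivalence)
open import Relation.Binary.Definitions using (DecidableEquality)
open import Relation.Binary.PropositionalEquality using (_≡_; _≢_; refl; sym; trans; cong; cong₂; subst; subst₂)
open import Relation.Nullary using (¬_; contradiction)
open import Relation.Nullary.Decidable using (¬?; _×-dec_; dec⇒maybe)

open import Defs

infix 4 _≟_
_≟_ : DecidableEquality Word
_≟_ = ≡-dec _≟ᶠ_

length-take-≤ : ∀ {A : Set} {n} (xs : List A) → n ≤ length xs → length (take n xs) ≡ n
length-take-≤ {n = n} xs n≤ = trans (length-take n xs) (m≤n⇒m⊓n≡m n≤)

take-++ˡ : ∀ {A : Set} n (xs ys : List A) → n ≤ length xs → take n (xs ++ ys) ≡ take n xs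
take-++ˡ zero    xs       ys _         = refl
take-++ˡ (suc n) (x ∷ xs) ys (s≤s n≤) = cong (x ∷_) (take-++ˡ n xs ys n≤)

drop-++ˡ : ∀ {A : Set} n (xs ys : List A) → n ≤ length xs → drop n (xs ++ ys) ≡ drop n xs ++ ys
drop-++ˡ zero    xs       ys _         = refl
drop-++ˡ (suc n) (x ∷ xs) ys (s≤s n≤) = drop-++ˡ n xs ys n≤

take-length+ : ∀ {A : Set} n (xs ys : List A) → take (length xs + n) (xs ++ ys) ≡ xs ++ take n ys
take-length+ n []       ys = refl
take-length+ n (x ∷ xs) ys = cong (x ∷_) (take-length+ n xs ys)

drop-length+ : ∀ {A : Set} n (xs ys : List A) → drop (length xs + n) (xs ++ ys) ≡ drop n ys
drop-length+ n []       ys = refl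
drop-length+ n (x ∷ xs) ys = drop-length+ n xs ys

∈-─ : ∀ {A : Set} {x y : A} {ys} (x∈ys : x ∈ ys) → y ∈ ys → y ≢ x → y ∈ ys ─ x∈ys
∈-─ (here refl)  (here refl)  y≢x = contradiction refl y≢x
∈-─ (here refl)  (there y∈ys) _   = y∈ys
∈-─ (there x∈ys) (here refl)  _   = here refl
∈-─ (there x∈ys) (there y∈ys) y≢x = there (∈-─ x∈ys y∈ys y≢x)

unique∧⊆⇒length≤ : ∀ {A : Set} {xs ys : List A} → Unique xs → xs ⊆ ys → length xs ≤ length ys
unique∧⊆⇒length≤ {xs = []}     _                _  = z≤n
unique∧⊆⇒length≤ {xs = x ∷ xs} {ys} (x∉xs ∷ uxs) xs⊆ys =
  subst (suc (length xs) ≤_) (sym (length-removeAt′ ys _))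
    (s≤s (unique∧⊆⇒length≤ uxs λ y∈xs →
      ∈-─ x∈ys (xs⊆ys (there y∈xs)) (λ y≡x → All.lookup x∉xs y∈xs (sym y≡x))))
  where
  x∈ys : x ∈ ys
  x∈ys = xs⊆ys (here refl)

HasSquare : Word → Set
HasSquare w = Σ Word λ p → Σ Word λ v → Σ Word λ s → v ≢ [] × w ≡ p ++ v ++ v ++ s

squareFree-++⁻ˡ : ∀ x y → SquareFree (x ++ y) → SquareFree x
squareFree-++⁻ˡ x y sf (p , v , s , v≢[] , x≡) = sf (p , v , s ++ y , v≢[] , (begin
  x ++ y                   ≡⟨ cong (_++ y) x≡ ⟩
  (p ++ v ++ v ++ s) ++ y  ≡⟨ ++-assoc p (v ++ v ++ s) y ⟩
  p ++ (v ++ v ++ s) ++ y  ≡⟨ cong (p ++_) (++-assoc v (v ++ s) y) ⟩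
  p ++ v ++ (v ++ s) ++ y  ≡⟨ cong (λ z → p ++ v ++ z) (++-assoc v s y) ⟩
  p ++ v ++ v ++ s ++ y    ∎))
  where open Relation.Binary.PropositionalEquality.≡-Reasoning

squareFree-++⁻ʳ : ∀ x y → SquareFree (x ++ y) → SquareFree y
squareFree-++⁻ʳ x y sf (p , v , s , v≢[] , y≡) =
  sf (x ++ p , v , s , v≢[] , trans (cong (x ++_) y≡) (sym (++-assoc x p (v ++ v ++ s))))

period⇒square : ∀ {w q} → IsPeriod w q → q + q ≤ length w → HasSquare w
period⇒square {w} {q} (1≤q , _ , zero , t , []≡wt) 2q≤|w| =
  contradiction (≤-trans (≤-reflexive |w|≡0) z≤n) (<⇒≱ (≤-trans (m<m+n q 1≤q) 2q≤|w|))
  where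
  |w|≡0 : length w ≡ 0
  |w|≡0 = cong length (++-conicalˡ w t (sym []≡wt))
period⇒square {w} {q} (1≤q , q≤|w| , suc zero , t , z≡wt) 2q≤|w| =
  contradiction (≤-trans (length-++-≤ˡ w) (≤-reflexive |wt|≡q)) (<⇒≱ (≤-trans (m<m+n q 1≤q) 2q≤|w|))
  where
  |wt|≡q : length (w ++ t) ≡ q
  |wt|≡q = trans (cong length (sym z≡wt))
    (trans (cong length (++-identityʳ (take q w))) (length-take-≤ w q≤|w|))
period⇒square {w} {q} (1≤q , q≤|w| , suc (suc k) , t , zzr≡wt) 2q≤|w| =
  [] , z , drop (q + q) w , z≢[] , (begin
    w                                 ≡⟨ sym (take++drop≡id (q + q) w) ⟩
    take (q + q) w ++ drop (q + q) w  ≡⟨ cong (_++ drop (q + q) w) take2q≡zz ⟩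
    (z ++ z) ++ drop (q + q) w        ≡⟨ ++-assoc z z _ ⟩
    z ++ z ++ drop (q + q) w          ∎)
  where
  open Relation.Binary.PropositionalEquality.≡-Reasoning
  z = take q w
  |z|≡q : length z ≡ q
  |z|≡q = length-take-≤ w q≤|w|
  z≢[] : z ≢ []
  z≢[] z≡[] = <⇒≱ 1≤q (≤-reflexive (trans (sym |z|≡q) (cong length z≡[])))
  |zz|≡2q : length (z ++ z) ≡ q + q
  |zz|≡2q = trans (length-++ z) (cong₂ _+_ |z|≡q |z|≡q)
  take2q≡zz : take (q + q) w ≡ z ++ z
  take2q≡zz = begin
    take (q + q) w                        ≡⟨ sym (take-++ˡ (q + q) w t 2q≤|w|) ⟩
    take (q + q) (w ++ t)                 ≡⟨ cong (take (q + q)) (sym zzr≡wt) ⟩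
    take (q + q) (z ++ z ++ _)            ≡⟨ cong (take (q + q)) (sym (++-assoc z z _)) ⟩
    take (q + q) ((z ++ z) ++ _)          ≡⟨ take-++ˡ (q + q) (z ++ z) _ (≤-reflexive (sym |zz|≡2q)) ⟩
    take (q + q) (z ++ z)                 ≡⟨ take-all (q + q) (z ++ z) (≤-reflexive |zz|≡2q) ⟩
    z ++ z                                ∎

squareFree⇒period>half : ∀ {w q} → SquareFree w → IsPeriod w q → length w < q + q
squareFree⇒period>half sf period = ≰⇒> (sf ∘ period⇒square period)

critical⇒repWord>half : ∀ {w p u} → SquareFree w → Critical w p → RepWord w p u →
                        length w < length u + length u
critical⇒repWord>half {u = u} sf (_ , n , (_ , n≤rep) , (period , _)) rep =
  ≤-trans (squareFree⇒period>half sf period) (+-mono-≤ n≤|u| n≤|u|)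
  where
  n≤|u| : n ≤ length u
  n≤|u| = n≤rep u rep

-- The two one-sided shapes of a repetition word at p that sticks out of the word at one end only.
LeftRep : Word → ℕ → Word → Set
LeftRep a p u = u ≢ [] × (Σ Word λ x' → u ≡ x' ++ take p a) × (Σ Word λ y' → drop p a ≡ u ++ y')

RightRep : Word → ℕ → Word → Set
RightRep b q u = u ≢ [] × (Σ Word λ x' → take q b ≡ x' ++ u) × (Σ Word λ y' → u ≡ drop q b ++ y')

Short : (Word → Set) → Set
Short R = Σ Word λ u → R u × length u ≤ 13

leftRep⇒repWord : ∀ {a p u} r → p ≤ length a → LeftRep a p u → RepWord (a ++ r) p u
leftRep⇒repWord {a} {p} {u} r p≤|a| (u≢[] , (x' , u≡) , (y' , drop≡)) =
  u≢[] , (x' , inj₁ (trans u≡ (cong (x' ++_) (sym (take-++ˡ p a r p≤|a|))))) ,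
  (y' ++ r , inj₂ (trans (drop-++ˡ p a r p≤|a|) (trans (cong (_++ r) drop≡) (++-assoc u y' r))))

rightRep⇒repWord : ∀ {b q u} l → RightRep b q u → RepWord (l ++ b) (length l + q) u
rightRep⇒repWord {b} {q} {u} l (u≢[] , (x' , take≡) , (y' , u≡)) =
  u≢[] , (l ++ x' , inj₂ (trans (take-length+ q l b) (trans (cong (l ++_) take≡) (sym (++-assoc l x' u))))) ,
  (y' , inj₁ (trans u≡ (cong (_++ y') (sym (drop-length+ q l b)))))

fromIsJust : ∀ {A : Set} (m : Maybe A) → T (is-just m) → A
fromIsJust (just x) _ = x

-- The searches below are only sound: whatever they return is correct by construction.
prefixSquare? : (w : Word) → Maybe (HasSquare w)
prefixSquare? w = head (mapMaybe candidate (upTo (length w)))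
  where
  candidate : ℕ → Maybe (HasSquare w)
  candidate L = Maybe.map (λ (v≢[] , w≡) → [] , v , _ , v≢[] , w≡)
    (dec⇒maybe (¬? (v ≟ []) ×-dec w ≟ v ++ v ++ drop (L + L) w))
    where v = take L w

shortLeftRep? : (a : Word) (p : ℕ) → Maybe (Short (LeftRep a p))
shortLeftRep? a p = head (mapMaybe candidate (upTo 14))
  where
  candidate : ℕ → Maybe (Short (LeftRep a p))
  candidate L =
    Maybe.map (λ (u≢[] , short , u≡) → u , (u≢[] , (_ , u≡) , (_ , sym (take++drop≡id L (drop p a)))) , short)
      (dec⇒maybe (¬? (u ≟ []) ×-dec length u ≤? 13 ×-dec u ≟ take (L ∸ p) u ++ take p a))
    where u = take L (drop p a)

shortRightRep? : (b : Word) (q : ℕ) → Maybe (Short (RightRep b q))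
shortRightRep? b q = head (mapMaybe candidate (upTo 14))
  where
  candidate : ℕ → Maybe (Short (RightRep b q))
  candidate L =
    Maybe.map (λ (u≢[] , short , u≡) → u , (u≢[] , (_ , sym (take++drop≡id (q ∸ L) (take q b))) , (_ , u≡)) , short)
      (dec⇒maybe (¬? (u ≟ []) ×-dec length u ≤? 13 ×-dec u ≟ drop q b ++ drop (length (drop q b)) u))
    where u = drop (q ∸ L) (take q b)

module _ {P : Word → Set} (check : (w : Word) → Maybe (P w)) where

  -- Runs check on every square-free t ʳ++ s with |t| = k, pruning as soon as a square prefix appears.
  checkExtensions : ℕ → Word → Bool
  checkExtension : ℕ → Word → Fin 3 → Bool

  checkExtensions zero    s = is-just (check s)
  checkExtensions (suc k) s = all (checkExtension k s) (allFin 3)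

  checkExtension k s c = is-just (prefixSquare? (c ∷ s)) ∨ checkExtensions k (c ∷ s)

  checkExtensions-sound : ∀ k s → T (checkExtensions k s) →
                          ∀ t → length t ≡ k → SquareFree (t ʳ++ s) → P (t ʳ++ s)
  checkExtensions-sound zero    s ok []      refl _  = fromIsJust (check s) ok
  checkExtensions-sound (suc k) s ok (c ∷ t) refl sf
    with Equivalence.to T-∨ (All.lookup (all⁺ (checkExtension k s) (allFin 3) ok) (∈-allFin c))
  ... | inj₁ square = contradiction (fromIsJust (prefixSquare? (c ∷ s)) square)
                        (squareFree-++⁻ʳ (reverse t) (c ∷ s) (subst SquareFree (ʳ++-defn t) sf))
  ... | inj₂ ok′    = checkExtensions-sound k (c ∷ s) ok′ t refl sf

  checkExtensions-squareFree : ∀ n → T (checkExtensions n []) →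
                               ∀ w → length w ≡ n → SquareFree w → P w
  checkExtensions-squareFree n ok w |w|≡n sf =
    subst P reverse²≡w (checkExtensions-sound n [] ok (reverse w) (trans (length-reverse w) |w|≡n)
      (subst SquareFree (sym reverse²≡w) sf))
    where
    reverse²≡w : reverse w ʳ++ [] ≡ w
    reverse²≡w = trans (ʳ++-defn (reverse w)) (trans (++-identityʳ _) (reverse-involutive w))

BorderRepetitions : Word → Set
BorderRepetitions a = Short (LeftRep a 1) × Short (LeftRep a 2) × Short (RightRep a 13) × Short (RightRep a 14)

borderRepetitions? : (a : Word) → Maybe (BorderRepetitions a)
borderRepetitions? a =
  zip (shortLeftRep? a 1) (zip (shortLeftRep? a 2) (zip (shortRightRep? a 13) (shortRightRep? a 14)))

squareFree⇒borderRepetitions : ∀ a → length a ≡ 15 → SquareFree a → BorderRepetitions a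
squareFree⇒borderRepetitions = checkExtensions-squareFree borderRepetitions? 15 tt

shortRep⇒¬critical : ∀ {w p} → SquareFree w → 26 ≤ length w → Short (RepWord w p) → ¬ Critical w p
shortRep⇒¬critical sf 26≤|w| (u , rep , |u|≤13) crit =
  <⇒≱ (critical⇒repWord>half sf crit rep) (≤-trans (+-mono-≤ |u|≤13 |u|≤13) 26≤|w|)

shortRepsAtEnds : ∀ {w} → SquareFree w → 15 ≤ length w → let m = length w ∸ 15 in
  Short (RepWord w 1) × Short (RepWord w 2) × Short (RepWord w (13 + m)) × Short (RepWord w (14 + m))
shortRepsAtEnds {w} sf 15≤|w| =
  let left1 , left2 , _ , _     = squareFree⇒borderRepetitions a |a|≡15 sf-a
      _ , _ , right13 , right14 = squareFree⇒borderRepetitions b |b|≡15 sf-b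
  in onPrefix (s≤s z≤n) left1 , onPrefix (s≤s (s≤s z≤n)) left2 , onSuffix right13 , onSuffix right14
  where
  m = length w ∸ 15
  a = take 15 w
  l = take m w
  b = drop m w

  |a|≡15 : length a ≡ 15
  |a|≡15 = length-take-≤ w 15≤|w|
  |l|≡m : length l ≡ m
  |l|≡m = length-take-≤ w (m∸n≤m (length w) 15)
  |b|≡15 : length b ≡ 15
  |b|≡15 = trans (length-drop m w) (m∸[m∸n]≡n 15≤|w|)

  sf-a : SquareFree a
  sf-a = squareFree-++⁻ˡ a (drop 15 w) (subst SquareFree (sym (take++drop≡id 15 w)) sf)
  sf-b : SquareFree b
  sf-b = squareFree-++⁻ʳ l b (subst SquareFree (sym (take++drop≡id m w)) sf)

  onPrefix : ∀ {p} → p ≤ 15 → Short (LeftRep a p) → Short (RepWord w p)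
  onPrefix p≤15 (u , rep , short) =
    u , subst (λ x → RepWord x _ u) (take++drop≡id 15 w)
          (leftRep⇒repWord (drop 15 w) (subst (_ ≤_) (sym |a|≡15) p≤15) rep) , short

  onSuffix : ∀ {q} → Short (RightRep b q) → Short (RepWord w (q + m))
  onSuffix {q} (u , rep , short) =
    u , subst₂ (λ x n → RepWord x n u) (take++drop≡id m w) (trans (cong (_+ q) |l|≡m) (+-comm m q))
          (rightRep⇒repWord l rep) , short

∈-interior : ∀ {m p} → 1 ≤ p → p < 15 + m → p ≢ 1 → p ≢ 2 → p ≢ 13 + m → p ≢ 14 + m →
             p ∈ applyUpTo (3 +_) (10 + m)
∈-interior {p = suc zero}          _ _ p≢1 _   _ _ = contradiction refl p≢1
∈-interior {p = suc (suc zero)}    _ _ _   p≢2 _ _ = contradiction refl p≢2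
∈-interior {m} {suc (suc (suc k))} _ (s≤s (s≤s (s≤s k<12+m))) _ _ p≢13+m p≢14+m =
  ∈-applyUpTo⁺ (3 +_) k<10+m
  where
  k<11+m : k < 11 + m
  k<11+m = ≤-pred (≤∧≢⇒< k<12+m (p≢14+m ∘ cong (2 +_)))
  k<10+m : k < 10 + m
  k<10+m = ≤-pred (≤∧≢⇒< k<11+m (p≢13+m ∘ cong (2 +_)))

critical⇒interior : ∀ {w p} → SquareFree w → 26 ≤ length w → Critical w p →
                    p ∈ applyUpTo (3 +_) (length w ∸ 5)
critical⇒interior {w} {p} sf 26≤|w| crit@((1≤p , p<|w|) , _) =
  let at1 , at2 , at13+m , at14+m = shortRepsAtEnds sf 15≤|w|
  in subst (λ n → p ∈ applyUpTo (3 +_) (n ∸ 5)) 15+m≡|w|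
       (∈-interior 1≤p (subst (p <_) (sym 15+m≡|w|) p<|w|)
         (notAt at1) (notAt at2) (notAt at13+m) (notAt at14+m))
  where
  15≤|w| : 15 ≤ length w
  15≤|w| = ≤-trans (m≤m+n 15 11) 26≤|w|
  15+m≡|w| : 15 + (length w ∸ 15) ≡ length w
  15+m≡|w| = m+[n∸m]≡n 15≤|w|
  notAt : ∀ {q} → Short (RepWord w q) → p ≢ q
  notAt short refl = shortRep⇒¬critical sf 26≤|w| short crit

mainTheorem7 : (w : Word) → SquareFree w → 26 ≤ length w →
    (S : List ℕ) → Unique S → All (Critical w) S → length S ≤ length w ∸ 5
mainTheorem7 w sf 26≤|w| S unique critical =
  ≤-trans (unique∧⊆⇒length≤ unique (λ p∈S → critical⇒interior sf 26≤|w| (All.lookup critical p∈S)))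
          (≤-reflexive (length-applyUpTo (3 +_) (length w ∸ 5)))
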